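{- Every AT-free graph satisfies the $(1,2)$-bow metric.
   Context: Graphs are finite, simple, unweighted, undirected, connected, with shortest-path distance $d$. An asteroidal triple is an independent set of three vertices such that each pair is joined by a path avoiding the (closed) neighborhood of the third; a graph is AT-free if it has no asteroidal triple. The interval is $I(u,v)=\{z: d(u,z)+d(z,v)=d(u,v)\}$. A graph satisfies the $(\lambda,\mu)$-bow metric if for all vertices $u,v,w,x$ with $v\in I(u,w)$, $w\in I(v,x)$ and $d(v,w)>\lambda$, one has $d(u,x)\ge d(u,v)+d(v,w)+d(w,x)-\mu$. -}

module Defs where

open import Data.Nat using (ℕ; zero; suc; _≤_; _<_; _+_)
open import Data.Sum using (_⊎_)
open import Data.Fin using (Fin)
open import Data.Product using (_×_; ∃)
open import Relation.Nullary using (¬_; Dec)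
open import Relation.Binary.PropositionalEquality using (_≡_)

record Graph : Set₁ where
  field
    n      : ℕ
    Adj    : Fin n → Fin n → Set
    adj?   : ∀ u v → Dec (Adj u v)
    sym    : ∀ {u v} → Adj u v → Adj v u
    irrefl : ∀ {u} → ¬ Adj u u

module _ (G : Graph) where
  open Graph G

  V : Set
  V = Fin n

  data Walk : V → V → ℕ → Set where
    nil  : ∀ {u} → Walk u u 0
    cons : ∀ {u w v k} → Adj u w → Walk w v k → Walk u v (suc k)

  Connected : Set
  Connected = ∀ u v → ∃ λ k → Walk u v k

  IsDist : V → V → ℕ → Set
  IsDist u v k = Walk u v k × (∀ m → Walk u v m → k ≤ m)

  InClosedNbhd : V → V → Set
  InClosedNbhd c z = (z ≡ c) ⊎ Adj z c

  data AvoidingWalk (c : V) : V → V → Set where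
    nil  : ∀ {u} → ¬ InClosedNbhd c u → AvoidingWalk c u u
    cons : ∀ {u w v} → ¬ InClosedNbhd c u → Adj u w →
           AvoidingWalk c w v → AvoidingWalk c u v

  Independent3 : V → V → V → Set
  Independent3 a b c =
    ¬ a ≡ b × ¬ b ≡ c × ¬ a ≡ c × ¬ Adj a b × ¬ Adj b c × ¬ Adj a c

  AsteroidalTriple : V → V → V → Set
  AsteroidalTriple a b c =
    Independent3 a b c × AvoidingWalk c a b × AvoidingWalk a b c × AvoidingWalk b a c

  ATFree : Set
  ATFree = ∀ a b c → ¬ AsteroidalTriple a b c

  -- (λ,μ)-bow metric, with distances given relationally.
  -- v ∈ I(u,w) : d(u,v)+d(v,w) = d(u,w);  w ∈ I(v,x) : d(v,w)+d(w,x) = d(v,x).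
  -- Conclusion d(u,x) ≥ d(u,v)+d(v,w)+d(w,x) - μ is written d(u,x)+μ ≥ … in ℕ.
  BowMetric : ℕ → ℕ → Set
  BowMetric lam mu =
    ∀ u v w x (duv dvw dwx duw dvx dux : ℕ) →
    IsDist u v duv → IsDist v w dvw → IsDist w x dwx →
    IsDist u w duw → IsDist v x dvx → IsDist u x dux →
    duv + dvw ≡ duw →
    dvw + dwx ≡ dvx →
    lam < dvw →
    duv + dvw + dwx ≤ dux + mu

{-# OPTIONS --safe #-}
module Submission where

-- Suppose d(u,x) + 2 < d(u,v) + d(v,w) + d(w,x) with d(v,w) ≥ 2.  Cut a shortest u–x path
-- at a vertex z with d(u,z) ≤ d(u,w) − 2 and d(z,x) ≤ d(v,x) − 2.  Then v, w, z is an
-- asteroidal triple: v reaches z through u outside N[w] and w reaches z through x outside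
-- N[v], since every vertex on the way is too close to u (resp. x) to be adjacent to w
-- (resp. v); and a vertex q of a shortest v–w path with d(q,z) ≤ 1 would give
-- d(u,w) + d(v,x) ≤ d(u,x) + d(v,w) + 2, which is the bow inequality.

open import Defs
open import Data.Nat
open import Data.Nat.Properties
open import Data.Nat.Tactic.RingSolver using (solve-∀)
open import Data.Product using (Σ; ∃; _×_; _,_; uncurry)
open import Data.Sum using (inj₁; inj₂)
open import Data.Empty using (⊥-elim)
open import Function using (_∘_)
open import Relation.Nullary using (¬_; yes; no)
open import Relation.Binary.PropositionalEquality using (_≡_; refl; cong; subst; subst₂)

i≤n+k⇒i+2≤n+[2+k] : ∀ {i n} k → i ≤ n + k → i + 2 ≤ n + (2 + k)
i≤n+k⇒i+2≤n+[2+k] {i} {n} k i≤n+k = begin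
  i + 2        ≤⟨ +-monoˡ-≤ 2 i≤n+k ⟩
  n + k + 2    ≡⟨ +-assoc n k 2 ⟩
  n + (k + 2)  ≡⟨ cong (n +_) (+-comm k 2) ⟩
  n + (2 + k)  ∎
  where open ≤-Reasoning

i≤k+n⇒i+2≤2+k+n : ∀ {i n} k → i ≤ k + n → i + 2 ≤ (2 + k) + n
i≤k+n⇒i+2≤2+k+n {i} {n} k i≤k+n = subst (_≤ 2 + (k + n)) (+-comm 2 i) (+-monoʳ-≤ 2 i≤k+n)

n+2<d+[2+k]+e⇒n≤d+k+e : ∀ n d k e → n + 2 < d + (2 + k) + e → n ≤ d + k + e
n+2<d+[2+k]+e⇒n≤d+k+e n d k e n+2<d =
  <⇒≤ (+-cancelˡ-< 2 n (d + k + e) (subst₂ _<_ (+-comm n 2) (regroup d k e) n+2<d))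
  where
  regroup : ∀ d k e → d + (2 + k) + e ≡ 2 + (d + k + e)
  regroup = solve-∀

n+2<d+K+e⇒n+K+2<d+K+[K+e] : ∀ n d K e → n + 2 < d + K + e → n + K + 2 < d + K + (K + e)
n+2<d+K+e⇒n+K+2<d+K+[K+e] n d K e n+2<d = begin-strict
  n + K + 2        ≡⟨ swap n K ⟩
  n + 2 + K        <⟨ +-monoˡ-< K n+2<d ⟩
  d + K + e + K    ≡⟨ regroup d K e ⟩
  d + K + (K + e)  ∎
  where
  open ≤-Reasoning
  swap : ∀ n K → n + K + 2 ≡ n + 2 + K
  swap = solve-∀
  regroup : ∀ d K e → d + K + e + K ≡ d + K + (K + e)
  regroup = solve-∀

j+[e+b]+[a+[e+r]]≤j+r+[a+b]+2 : ∀ j r a b {e} → e ≤ 1 →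
                                j + (e + b) + (a + (e + r)) ≤ j + r + (a + b) + 2
j+[e+b]+[a+[e+r]]≤j+r+[a+b]+2 j r a b {e} e≤1 = begin
  j + (e + b) + (a + (e + r))  ≡⟨ regroup j r a b e ⟩
  j + r + (a + b) + (e + e)    ≤⟨ +-monoʳ-≤ (j + r + (a + b)) (+-mono-≤ e≤1 e≤1) ⟩
  j + r + (a + b) + 2          ∎
  where
  open ≤-Reasoning
  regroup : ∀ j r a b e → j + (e + b) + (a + (e + r)) ≡ j + r + (a + b) + (e + e)
  regroup = solve-∀

module _ (G : Graph) where
  open Graph G renaming (sym to Adj-sym)

  DistAtLeast : V G → V G → ℕ → Set
  DistAtLeast a b D = ∀ m → Walk G a b m → D ≤ m

  infixr 5 _++_

  _++_ : ∀ {a b c k l} → Walk G a b k → Walk G b c l → Walk G a c (k + l)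
  nil      ++ q = q
  cons e p ++ q = cons e (p ++ q)

  reverse : ∀ {a b k} → Walk G a b k → Walk G b a k
  reverse nil                = nil
  reverse (cons {k = k} e p) = subst (Walk G _ _) (+-comm k 1) (reverse p ++ cons (Adj-sym e) nil)

  reverse-DistAtLeast : ∀ {a b D} → DistAtLeast a b D → DistAtLeast b a D
  reverse-DistAtLeast a⋯b m = a⋯b m ∘ reverse

  splitAt : ∀ {a b L} A B → Walk G a b L → L ≤ A + B →
            ∃ λ z → Σ ℕ λ j → Σ ℕ λ r → Walk G a z j × Walk G z b r × j + r ≡ L × j ≤ A × r ≤ B
  splitAt zero    B p          L≤B         = _ , 0 , _ , nil , p , refl , z≤n , L≤B
  splitAt (suc A) B nil        _           = _ , 0 , 0 , nil , nil , refl , z≤n , z≤n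
  splitAt (suc A) B (cons e p) (s≤s L≤A+B) with splitAt A B p L≤A+B
  ... | z , j , r , p₁ , p₂ , refl , j≤A , r≤B =
    z , suc j , r , cons e p₁ , p₂ , refl , s≤s j≤A , r≤B

  closedNbhd-walks : ∀ {c y} → InClosedNbhd G c y → ∃ λ e → e ≤ 1 × Walk G y c e × Walk G c y e
  closedNbhd-walks (inj₁ refl) = 0 , z≤n , nil , nil
  closedNbhd-walks (inj₂ y~c)  = 1 , ≤-refl , cons y~c nil , cons (Adj-sym y~c) nil

  ∉closedNbhd-if-far : ∀ {a c y D i} → DistAtLeast a c D → Walk G a y i → i + 2 ≤ D →
                       ¬ InClosedNbhd G c y
  ∉closedNbhd-if-far {i = i} a⋯c p i+2≤D y∈N[c] with closedNbhd-walks y∈N[c]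
  ... | e , e≤1 , y→c , _ =
    <-irrefl refl (+-cancelˡ-≤ i 2 1 (≤-trans i+2≤D (≤-trans (a⋯c _ (p ++ y→c)) (+-monoʳ-≤ i e≤1))))

  toAvoidingWalk : ∀ {c a b L} → Walk G a b L →
                   (∀ {y i m} → Walk G a y i → Walk G y b m → i + m ≡ L → ¬ InClosedNbhd G c y) →
                   AvoidingWalk G c a b
  toAvoidingWalk nil        y∉N[c] = nil (y∉N[c] nil nil refl)
  toAvoidingWalk (cons e p) y∉N[c] =
    cons (y∉N[c] nil (cons e p) refl) e
         (toAvoidingWalk p λ p₁ p₂ eq → y∉N[c] (cons e p₁) p₂ (cong suc eq))

  headᵃ : ∀ {c a b} → AvoidingWalk G c a b → ¬ InClosedNbhd G c a
  headᵃ (nil a∉N[c])      = a∉N[c]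
  headᵃ (cons a∉N[c] _ _) = a∉N[c]

  lastᵃ : ∀ {c a b} → AvoidingWalk G c a b → ¬ InClosedNbhd G c b
  lastᵃ (nil b∉N[c]) = b∉N[c]
  lastᵃ (cons _ _ p) = lastᵃ p

  infixr 5 _++ᵃ_

  _++ᵃ_ : ∀ {c a b d} → AvoidingWalk G c a b → AvoidingWalk G c b d → AvoidingWalk G c a d
  nil _      ++ᵃ q = q
  cons h e p ++ᵃ q = cons h e (p ++ᵃ q)

  reverseᵃ : ∀ {c a b} → AvoidingWalk G c a b → AvoidingWalk G c b a
  reverseᵃ (nil h)      = nil h
  reverseᵃ (cons h e p) = let q = reverseᵃ p in q ++ᵃ cons (lastᵃ q) (Adj-sym e) (nil h)

  avoidingWalks⇒asteroidalTriple : ∀ {a b c} →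
    AvoidingWalk G c a b → AvoidingWalk G a b c → AvoidingWalk G b a c → AsteroidalTriple G a b c
  avoidingWalks⇒asteroidalTriple {a} {b} {c} a⇝b b⇝c a⇝c = independent , a⇝b , b⇝c , a⇝c
    where
    independent : Independent3 G a b c
    independent = headᵃ a⇝c ∘ inj₁ , lastᵃ a⇝b ∘ inj₁ , headᵃ a⇝b ∘ inj₁ ,
                  headᵃ a⇝c ∘ inj₂ , lastᵃ a⇝b ∘ inj₂ , headᵃ a⇝b ∘ inj₂

  avoidingWalk-near : ∀ {u v w z D i j} → DistAtLeast u w D →
                      Walk G u v i → Walk G u z j → i + 2 ≤ D → j + 2 ≤ D → AvoidingWalk G w v z
  avoidingWalk-near {u} {w = w} {D = D} u⋯w u→v u→z i+2≤D j+2≤D =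
    reverseᵃ (avoiding u→v i+2≤D) ++ᵃ avoiding u→z j+2≤D
    where
    avoiding : ∀ {y k} → Walk G u y k → k + 2 ≤ D → AvoidingWalk G w u y
    avoiding p k+2≤D = toAvoidingWalk p λ {_} {i} {m} u→y _ i+m≡k →
      ∉closedNbhd-if-far u⋯w u→y (≤-trans (+-monoˡ-≤ 2 (subst (i ≤_) i+m≡k (m≤m+n i m))) k+2≤D)

  avoidingWalk-nearʳ : ∀ {x v w z D i j} → DistAtLeast v x D →
                       Walk G w x i → Walk G z x j → i + 2 ≤ D → j + 2 ≤ D → AvoidingWalk G v w z
  avoidingWalk-nearʳ v⋯x w→x z→x =
    avoidingWalk-near (reverse-DistAtLeast v⋯x) (reverse w→x) (reverse z→x)

  avoidingWalk-detour : ∀ {u v w x z D₁ D₂ j r K} → DistAtLeast u w D₁ → DistAtLeast v x D₂ →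
                        Walk G u z j → Walk G z x r → Walk G v w K → j + r + K + 2 < D₁ + D₂ →
                        AvoidingWalk G z v w
  avoidingWalk-detour {v = v} {w} {z = z} {D₁} {D₂} {j} {r} {K} u⋯w v⋯x u→z z→x v→w short =
    toAvoidingWalk v→w q∉N[z]
    where
    q∉N[z] : ∀ {q a b} → Walk G v q a → Walk G q w b → a + b ≡ K → ¬ InClosedNbhd G z q
    q∉N[z] {a = a} {b} v→q q→w a+b≡K q∈N[z] with closedNbhd-walks q∈N[z]
    ... | e , e≤1 , q→z , z→q = <⇒≱ short (begin
      D₁ + D₂                      ≤⟨ +-mono-≤ (u⋯w _ (u→z ++ z→q ++ q→w)) (v⋯x _ (v→q ++ q→z ++ z→x)) ⟩
      j + (e + b) + (a + (e + r))  ≤⟨ j+[e+b]+[a+[e+r]]≤j+r+[a+b]+2 j r a b e≤1 ⟩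
      j + r + (a + b) + 2          ≡⟨ cong (λ K → j + r + K + 2) a+b≡K ⟩
      j + r + K + 2                ∎)
      where open ≤-Reasoning

  bow-violation⇒asteroidalTriple : ∀ {u v w x duv k dwx dux} →
    Walk G u v duv → Walk G v w (2 + k) → Walk G w x dwx → Walk G u x dux →
    DistAtLeast u w (duv + (2 + k)) → DistAtLeast v x ((2 + k) + dwx) →
    dux + 2 < duv + (2 + k) + dwx → ∃ λ z → AsteroidalTriple G v w z
  bow-violation⇒asteroidalTriple {duv = duv} {k} {dwx} {dux} u→v v→w w→x u→x u⋯w v⋯x short
    with splitAt (duv + k) dwx u→x (n+2<d+[2+k]+e⇒n≤d+k+e dux duv k dwx short)
  ... | z , j , r , u→z , z→x , refl , j≤duv+k , r≤dwx = z , avoidingWalks⇒asteroidalTriple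
    (avoidingWalk-detour u⋯w v⋯x u→z z→x v→w
      (n+2<d+K+e⇒n+K+2<d+K+[K+e] (j + r) duv (2 + k) dwx short))
    (avoidingWalk-nearʳ v⋯x w→x z→x
      (i≤k+n⇒i+2≤2+k+n k (m≤n+m dwx k)) (i≤k+n⇒i+2≤2+k+n k (≤-trans r≤dwx (m≤n+m dwx k))))
    (avoidingWalk-near u⋯w u→v u→z
      (i≤n+k⇒i+2≤n+[2+k] k (m≤m+n duv k)) (i≤n+k⇒i+2≤n+[2+k] k j≤duv+k))

proposition4 : (G : Graph) → Connected G → ATFree G → BowMetric G 1 2
proposition4 G _ atFree u v w x duv .(2 + k) dwx .(duv + (2 + k)) .((2 + k) + dwx) dux
  (u→v , _) (v→w , _) (w→x , _) (_ , u⋯w) (_ , v⋯x) (u→x , _) refl refl (s≤s (s≤s {n = k} _))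
  with duv + (2 + k) + dwx ≤? dux + 2
... | yes bow = bow
... | no ¬bow =
  ⊥-elim (uncurry (atFree v w) (bow-violation⇒asteroidalTriple G u→v v→w w→x u→x u⋯w v⋯x (≰⇒> ¬bow)))
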